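{- Let $m\geq 2$, $q\geq 2$ and let $C$ be one of the following codes in $H(m,q)$: (i) $\mathrm{Rep}(m,q)$; (ii) $\mathrm{Inj}(m,q)$ with $m<q$; (iii) $W([m/2],2)$ with $q=2$ and $m\geq 3$ odd; (iv) $\mathrm{All}(pq,q)$ with $m=pq$ for a positive integer $p$. Then $C$ is neighbour transitive and $\mathrm{Aut}(C)=\mathrm{Diag}_m(S_q)\rtimes L$. Moreover, the minimum distance of $C$ is $m$, $1$, $1$, $2$ in cases (i), (ii), (iii), (iv) respectively.
   Context: $H(m,q)$ is the Hamming graph on $Q^m$, $|Q|=q$, adjacency = differing in exactly one entry. Its automorphism group is $B\rtimes L$ with $B\cong S_q^m$ acting entrywise and $L\cong S_m$ permuting entries; $\mathrm{Diag}_m(S_q)=\{(h,\ldots,h):h\in S_q\}\leq B$. $\mathrm{Aut}(C)$ is the setwise stabiliser of $C$. $C_1$ is the set of non-codewords adjacent to a codeword; $C$ is neighbour transitive if $C$ and $C_1$ are both orbits of some group of automorphisms. $\mathrm{Rep}(m,q)=\{(a,\ldots,a):a\in Q\}$; $\mathrm{Inj}(m,q)$ is the set of vertices with pairwise distinct entries; for $Q=\{0,1\}$, $W([m/2],2)$ is the set of vertices with exactly $(m-1)/2$ or $(m+1)/2$ entries equal to $1$; $\mathrm{All}(pq,q)$ is the set of vertices of $H(pq,q)$ in which every letter of $Q$ occurs exactly $p$ times. -}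

module Defs where

open import Data.Nat using (ℕ; suc; _+_; _*_; _≤_)
open import Data.Fin using (Fin; zero; suc; _≟_)
open import Data.Fin.Permutation using (Permutation′; _⟨$⟩ʳ_; _⟨$⟩ˡ_)
open import Data.List using (length; filter; allFin)
open import Data.Product using (Σ; ∃; _×_)
open import Data.Sum using (_⊎_)
open import Relation.Nullary using (¬_; ¬?)
open import Relation.Binary.PropositionalEquality using (_≡_; _≢_; _≗_)
open import Function.Bundles using (_⇔_)

-- Vertices of H(m,q): words Q^m with Q = Fin q.
Word : ℕ → ℕ → Set
Word m q = Fin m → Fin q

Code : ℕ → ℕ → Set₁
Code m q = Word m q → Set

dist : ∀ {m q} → Word m q → Word m q → ℕ
dist {m} x y = length (filter (λ i → ¬? (x i ≟ y i)) (allFin m))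

occ : ∀ {m q} → Word m q → Fin q → ℕ
occ {m} x a = length (filter (λ i → x i ≟ a) (allFin m))

Adjacent : ∀ {m q} → Word m q → Word m q → Set
Adjacent {m} x y = Σ (Fin m) λ i → (x i ≢ y i) × (∀ j → j ≢ i → x j ≡ y j)

Neighbours : ∀ {m q} → Code m q → Code m q
Neighbours C y = ¬ C y × Σ _ λ x → C x × Adjacent x y

-- Automorphisms of H(m,q): Aut(H(m,q)) = B ⋊ L, an element being given by
-- (h_1,...,h_m) ∈ S_q^m and σ ∈ S_m.
record Auto (m q : ℕ) : Set where
  constructor mkAuto
  field
    h : Fin m → Permutation′ q
    σ : Permutation′ m
open Auto public

act : ∀ {m q} → Auto m q → Word m q → Word m q
act g x j = h g j ⟨$⟩ʳ x (σ g ⟨$⟩ˡ j)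

IsAutGroup : ∀ {m q} → (Auto m q → Set) → Set
IsAutGroup {m} {q} G =
  (Σ (Auto m q) λ e → G e × (∀ x → act e x ≗ x)) ×
  (∀ g₁ g₂ → G g₁ → G g₂ → Σ (Auto m q) λ g₃ → G g₃ × (∀ x → act g₃ x ≗ act g₂ (act g₁ x))) ×
  (∀ g → G g → Σ (Auto m q) λ g' → G g' × (∀ x → act g' (act g x) ≗ x))

IsOrbit : ∀ {m q} → (Auto m q → Set) → Code m q → Set
IsOrbit G S = (∃ λ x → S x) × (∀ x y → S x → (S y ⇔ (∃ λ g → G g × act g x ≗ y)))

NeighbourTransitive : ∀ {m q} → Code m q → Set₁
NeighbourTransitive {m} {q} C =
  Σ (Auto m q → Set) λ G → IsAutGroup G × IsOrbit G C × IsOrbit G (Neighbours C)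

InAut : ∀ {m q} → Code m q → Auto m q → Set
InAut C g = ∀ x → C x ⇔ C (act g x)

-- Diag_m(S_q) ⋊ L: elements with h_1 = ... = h_m.
InDiagL : ∀ {m q} → Auto m q → Set
InDiagL g = ∀ i j a → h g i ⟨$⟩ʳ a ≡ h g j ⟨$⟩ʳ a

AutIsDiagL : ∀ {m q} → Code m q → Set
AutIsDiagL C = ∀ g → InAut C g ⇔ InDiagL g

MinDist : ∀ {m q} → Code m q → ℕ → Set
MinDist C d =
  (∃ λ x → ∃ λ y → C x × C y × ¬ (x ≗ y) × dist x y ≡ d) ×
  (∀ x y → C x → C y → ¬ (x ≗ y) → d ≤ dist x y)

Rep : ∀ {m q} → Code m q
Rep x = ∃ λ a → ∀ i → x i ≡ a

Inj : ∀ {m q} → Code m q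
Inj x = ∀ i j → x i ≡ x j → i ≡ j

-- W([m/2],2) for m = 2k+1: weight k or k+1.
W : ∀ {m} → (k : ℕ) → Code m 2
W k x = occ x (suc zero) ≡ k ⊎ occ x (suc zero) ≡ suc k

All : ∀ {m q} → (p : ℕ) → Code m q
All p x = ∀ a → occ x a ≡ p

Result : (m q : ℕ) → Code m q → ℕ → Set₁
Result m q C d = NeighbourTransitive C × AutIsDiagL C × MinDist C d

-- Each of the four codes is a union of orbits of Diag_m(S_q) ⋊ L, which permutes positions and relabels all
-- letters by one permutation: membership depends only on the letter counts up to relabelling (Rep, W, All)
-- or on which entries coincide (Inj).  Words with equal letter counts differ by a permutation of positions and
-- injective words by a permutation of letters, so the group is transitive on C; a neighbour is a codeword
-- with one entry changed, and the group moves the changed position and the two letters involved anywhere, so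
-- it is transitive on C₁ as well.
-- Conversely, if an automorphism (h₁,…,h_m)σ of C had h_i a ≢ h_j a, compare its images of a codeword z with
-- z(σ⁻¹i) = a and of z with the entries at σ⁻¹i, σ⁻¹j swapped: they differ only at i and j, and their letter
-- counts cannot both be those of codewords (for Inj, z is chosen so that its image repeats a letter).

module Submission where

open import Defs
open import Algebra.Properties.CommutativeMonoid.Sum as Sum using ()
open import Data.Empty using (⊥; ⊥-elim)
open import Data.Fin using (Fin; zero; suc; _≟_; punchIn; punchOut; splitAt; toℕ; inject≤; fromℕ<)
open import Data.Fin.Patterns using (0F; 1F)
open import Data.Fin.Permutation as P
  using (Permutation′; _⟨$⟩ʳ_; _⟨$⟩ˡ_; inverseˡ; inverseʳ; transpose; lift₀; _∘ₚ_)
open import Data.Fin.Properties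
  using (suc-injective; inject≤-injective; toℕ-inject≤; toℕ-fromℕ<; toℕ<n; punchInᵢ≢i; punchIn-punchOut;
         punchIn-injective; any?; ¬∀⟶∃¬)
open import Data.List using (length; filter; tabulate)
open import Data.Nat using (ℕ; zero; suc; _+_; _*_; _≤_; _<_; z≤n; s≤s)
open import Data.Nat.Properties as Nat
  using (+-0-commutativeMonoid; +-comm; +-assoc; +-identityʳ; +-suc; +-cancelˡ-≡; +-cancelʳ-≡; +-monoʳ-≤;
         m≤m+n; m≤n+m; n≤1+n; 1+n≰n; m≢1+m+n; ≤-refl; ≤-reflexive; ≤-trans; <⇒≤; <-irrefl; module ≤-Reasoning)
open import Data.Nat.Tactic.RingSolver using (solve-∀)
open import Data.Product using (∃; _×_; _,_; proj₁; proj₂)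
open import Data.Sum using (_⊎_; inj₁; inj₂; [_,_]; [_,_]′; map₁)
open import Data.Sum.Properties using ([,]-map; [,]-∘)
open import Data.Vec.Functional using (removeAt; updateAt; _++_; _∷_; [])
open import Data.Vec.Functional.Properties using (updateAt-updates; updateAt-minimal)
open import Function using (_∘_; _⇔_; const; id)
open import Function.Bundles using (Equivalence; Injection; mk⇔)
open import Function.Properties.Inverse using (↔⇒↣)
open import Relation.Binary using (_Respects_)
open import Relation.Binary.PropositionalEquality hiding ([_])
open import Relation.Nullary using (Dec; yes; no; ¬_; ¬?; contradiction; _×-dec_)
open import Relation.Nullary.Decidable using (dec-true; dec-false)
open import Relation.Unary using (Pred; Decidable)

open Sum +-0-commutativeMonoid using (sum; sum-cong-≗; sum-remove; sum-permute; sum-replicate-zero)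

private variable
  m n q : ℕ

indicator : ∀ {a} {A : Set a} → Dec A → ℕ
indicator (yes _) = 1
indicator (no _)  = 0

indicator-yes : ∀ {a} {A : Set a} (d : Dec A) → A → indicator d ≡ 1
indicator-yes (yes _) _ = refl
indicator-yes (no ¬a) a = contradiction a ¬a

indicator-no : ∀ {a} {A : Set a} (d : Dec A) → ¬ A → indicator d ≡ 0
indicator-no (yes a) ¬a = contradiction a ¬a
indicator-no (no _)  _  = refl

indicator-cong : ∀ {a b} {A : Set a} {B : Set b} (d : Dec A) (e : Dec B) → A ⇔ B → indicator d ≡ indicator e
indicator-cong (yes _) (yes _) _   = refl
indicator-cong (no _)  (no _)  _   = refl
indicator-cong (yes a) (no ¬b) A⇔B = contradiction (Equivalence.to A⇔B a) ¬b
indicator-cong (no ¬a) (yes b) A⇔B = contradiction (Equivalence.from A⇔B b) ¬a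

length-filter-tabulate : ∀ {a p} {A : Set a} {P : Pred A p} (P? : Decidable P) (f : Fin n → A) →
  length (filter P? (tabulate f)) ≡ sum (λ i → indicator (P? (f i)))
length-filter-tabulate {zero}  P? f = refl
length-filter-tabulate {suc n} P? f with P? (f zero)
... | yes _ = cong suc (length-filter-tabulate P? (f ∘ suc))
... | no _  = length-filter-tabulate P? (f ∘ suc)

term≤sum : (f : Fin n → ℕ) (i : Fin n) → f i ≤ sum f
term≤sum f zero    = m≤m+n (f zero) _
term≤sum f (suc i) = ≤-trans (term≤sum (f ∘ suc) i) (m≤n+m _ (f zero))

sum-agree-off : (f g : Fin n → ℕ) (i : Fin n) → (∀ j → j ≢ i → f j ≡ g j) → sum f + g i ≡ sum g + f i
sum-agree-off {suc n} f g i f≗g = begin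
  sum f + g i                     ≡⟨ cong (_+ g i) (sum-remove f) ⟩
  f i + sum (removeAt f i) + g i  ≡⟨ cong (λ s → f i + s + g i) (sum-cong-≗ (λ j → f≗g _ (punchInᵢ≢i i j))) ⟩
  f i + sum (removeAt g i) + g i  ≡⟨ swap-outer (f i) _ (g i) ⟩
  g i + sum (removeAt g i) + f i  ≡⟨ cong (_+ f i) (sum-remove g) ⟨
  sum g + f i                     ∎
  where
  open ≡-Reasoning
  swap-outer : ∀ a b c → a + b + c ≡ c + b + a
  swap-outer = solve-∀

sum-supported-at : (f : Fin n → ℕ) (i : Fin n) → (∀ j → j ≢ i → f j ≡ 0) → sum f ≡ f i
sum-supported-at {n} f i f≡0 = begin
  sum f                   ≡⟨ +-identityʳ (sum f) ⟨
  sum f + 0               ≡⟨ sum-agree-off f (λ _ → 0) i f≡0 ⟩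
  sum {n} (λ _ → 0) + f i ≡⟨ cong (_+ f i) (sum-replicate-zero n) ⟩
  f i                     ∎
  where open ≡-Reasoning

removeAt-punchOut : (f : Fin (suc n) → ℕ) {i j : Fin (suc n)} (i≢j : i ≢ j) → removeAt f i (punchOut i≢j) ≡ f j
removeAt-punchOut f i≢j = cong f (punchIn-punchOut i≢j)

sum-≥-two-terms : (f : Fin n → ℕ) {i j : Fin n} → i ≢ j → f i + f j ≤ sum f
sum-≥-two-terms {suc n} f {i} {j} i≢j = begin
  f i + f j                           ≡⟨ cong (f i +_) (removeAt-punchOut f i≢j) ⟨
  f i + removeAt f i (punchOut i≢j)   ≤⟨ +-monoʳ-≤ (f i) (term≤sum (removeAt f i) (punchOut i≢j)) ⟩
  f i + sum (removeAt f i)            ≡⟨ sum-remove f ⟨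
  sum f                               ∎
  where open ≤-Reasoning

sum-supported-at-two : (f : Fin n → ℕ) {i j : Fin n} → i ≢ j → (∀ t → t ≢ i → t ≢ j → f t ≡ 0) → sum f ≡ f i + f j
sum-supported-at-two {suc n} f {i} {j} i≢j f≡0 = begin
  sum f                               ≡⟨ sum-remove f ⟩
  f i + sum (removeAt f i)            ≡⟨ cong (f i +_) (sum-supported-at (removeAt f i) (punchOut i≢j) off-j) ⟩
  f i + removeAt f i (punchOut i≢j)   ≡⟨ cong (f i +_) (removeAt-punchOut f i≢j) ⟩
  f i + f j                           ∎
  where
  open ≡-Reasoning
  off-j : ∀ t → t ≢ punchOut i≢j → removeAt f i t ≡ 0
  off-j t t≢j′ = f≡0 _ (punchInᵢ≢i i t)
    (λ eq → t≢j′ (punchIn-injective i t _ (trans eq (sym (punchIn-punchOut i≢j)))))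

sum-agree-off-two : (f g : Fin n → ℕ) {i j : Fin n} → i ≢ j → (∀ t → t ≢ i → t ≢ j → f t ≡ g t) →
  sum f + g i + g j ≡ sum g + f i + f j
sum-agree-off-two f g {i} {j} i≢j f≗g = begin
  sum f + g i + g j  ≡⟨ cong (λ s → sum f + s + g j) (updateAt-updates i f) ⟨
  sum f + w i + g j  ≡⟨ cong (_+ g j) (sum-agree-off f w i f≗w) ⟩
  sum w + f i + g j  ≡⟨ shuffle (sum w) (f i) (g j) ⟩
  sum w + g j + f i  ≡⟨ cong (_+ f i) (sum-agree-off w g j w≗g) ⟩
  sum g + w j + f i  ≡⟨ cong (λ s → sum g + s + f i) (updateAt-minimal j i f (i≢j ∘ sym)) ⟩
  sum g + f j + f i  ≡⟨ shuffle (sum g) (f j) (f i) ⟩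
  sum g + f i + f j  ∎
  where
  open ≡-Reasoning
  w = updateAt f i (const (g i))
  shuffle : ∀ a b c → a + b + c ≡ a + c + b
  shuffle = solve-∀
  f≗w : ∀ t → t ≢ i → f t ≡ w t
  f≗w t t≢i = sym (updateAt-minimal t i f t≢i)
  w≗g : ∀ t → t ≢ j → w t ≡ g t
  w≗g t t≢j with t ≟ i
  ... | yes refl = updateAt-updates i f
  ... | no t≢i   = trans (updateAt-minimal t i f t≢i) (f≗g t t≢i t≢j)

sum-++ : (f : Fin m → ℕ) (g : Fin n → ℕ) → sum (f ++ g) ≡ sum f + sum g
sum-++ {zero}  f g = refl
sum-++ {suc m} f g = begin
  f zero + sum (λ i → [ f , g ] (map₁ suc (splitAt m i)))  ≡⟨ cong (f zero +_) (sum-cong-≗ ([,]-map ∘ splitAt m)) ⟩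
  f zero + sum (f ∘ suc ++ g)                               ≡⟨ cong (f zero +_) (sum-++ (f ∘ suc) g) ⟩
  f zero + (sum (f ∘ suc) + sum g)                          ≡⟨ +-assoc (f zero) _ _ ⟨
  sum f + sum g                                             ∎
  where open ≡-Reasoning

sum-ones : (f : Fin n → ℕ) → (∀ i → f i ≡ 1) → sum f ≡ n
sum-ones {zero}  f f≡1 = refl
sum-ones {suc n} f f≡1 = cong₂ _+_ (f≡1 zero) (sum-ones (f ∘ suc) (f≡1 ∘ suc))

permute-injective : (π : Permutation′ n) {a b : Fin n} → π ⟨$⟩ʳ a ≡ π ⟨$⟩ʳ b → a ≡ b
permute-injective π = Injection.injective (↔⇒↣ π)

transpose-i↦j : (i j : Fin n) → transpose i j ⟨$⟩ʳ i ≡ j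
transpose-i↦j i j rewrite dec-true (i ≟ i) refl = refl

transpose-j↦i : (i j : Fin n) → transpose i j ⟨$⟩ʳ j ≡ i
transpose-j↦i i j with j ≟ i
... | yes j≡i = j≡i
... | no _ rewrite dec-true (j ≟ j) refl = refl

transpose-fixes : {i j k : Fin n} → k ≢ i → k ≢ j → transpose i j ⟨$⟩ʳ k ≡ k
transpose-fixes {i = i} {j} {k} k≢i k≢j rewrite dec-false (k ≟ i) k≢i | dec-false (k ≟ j) k≢j = refl

inj-tail : {x : Word (suc m) q} → Inj x → Inj (x ∘ suc)
inj-tail x-inj i j eq = suc-injective (x-inj (suc i) (suc j) eq)

injections⇒relabelling : (x y : Fin m → Fin q) → Inj x → Inj y → ∃ λ π → ∀ i → π ⟨$⟩ʳ x i ≡ y i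
injections⇒relabelling {zero}  x y _ _ = P.id , λ ()
injections⇒relabelling {suc m} x y x-inj y-inj
  with π , π-maps ← injections⇒relabelling (x ∘ suc) (y ∘ suc) (inj-tail x-inj) (inj-tail y-inj) =
  π ∘ₚ transpose c (y zero) , maps
  where
  c = π ⟨$⟩ʳ x zero
  maps : ∀ i → transpose c (y zero) ⟨$⟩ʳ (π ⟨$⟩ʳ x i) ≡ y i
  maps zero    = transpose-i↦j c (y zero)
  maps (suc i) = trans (cong (transpose c (y zero) ⟨$⟩ʳ_) (π-maps i)) (transpose-fixes ≢c ≢y₀)
    where
    ≢c : y (suc i) ≢ c
    ≢c eq with () ← x-inj (suc i) zero (permute-injective π (trans (π-maps i) eq))
    ≢y₀ : y (suc i) ≢ y zero
    ≢y₀ eq with () ← y-inj (suc i) zero eq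

permutation-mapping-pair : {a b a′ b′ : Fin n} → a ≢ b → a′ ≢ b′ →
  ∃ λ π → π ⟨$⟩ʳ a ≡ a′ × π ⟨$⟩ʳ b ≡ b′
permutation-mapping-pair {a = a} {b} {a′} {b′} a≢b a′≢b′ =
  let π , π-maps = injections⇒relabelling (a ∷ b ∷ []) (a′ ∷ b′ ∷ []) (pair-inj a≢b) (pair-inj a′≢b′)
  in  π , π-maps zero , π-maps (suc zero)
  where
  pair-inj : ∀ {c d : Fin n} → c ≢ d → Inj (c ∷ d ∷ [])
  pair-inj c≢d zero          zero          _  = refl
  pair-inj c≢d (suc zero)    (suc zero)    _  = refl
  pair-inj c≢d zero          (suc zero)    eq = contradiction eq c≢d
  pair-inj c≢d (suc zero)    zero          eq = contradiction (sym eq) c≢d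

occ≡sum : (x : Word m q) (a : Fin q) → occ x a ≡ sum (λ i → indicator (x i ≟ a))
occ≡sum x a = length-filter-tabulate (λ i → x i ≟ a) id

occ-cong : {x y : Word m q} → x ≗ y → ∀ a → occ x a ≡ occ y a
occ-cong {x = x} {y} x≗y a = begin
  occ x a                              ≡⟨ occ≡sum x a ⟩
  sum (λ i → indicator (x i ≟ a))      ≡⟨ sum-cong-≗ (λ i → cong (λ b → indicator (b ≟ a)) (x≗y i)) ⟩
  sum (λ i → indicator (y i ≟ a))      ≡⟨ occ≡sum y a ⟨
  occ y a                              ∎
  where open ≡-Reasoning

occ-permute-positions : (x : Word m q) (ρ : Permutation′ m) (a : Fin q) → occ (λ i → x (ρ ⟨$⟩ʳ i)) a ≡ occ x a
occ-permute-positions x ρ a = begin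
  occ (λ i → x (ρ ⟨$⟩ʳ i)) a                  ≡⟨ occ≡sum (λ i → x (ρ ⟨$⟩ʳ i)) a ⟩
  sum (λ i → indicator (x (ρ ⟨$⟩ʳ i) ≟ a))    ≡⟨ sum-permute (λ i → indicator (x i ≟ a)) ρ ⟨
  sum (λ i → indicator (x i ≟ a))             ≡⟨ occ≡sum x a ⟨
  occ x a                                     ∎
  where open ≡-Reasoning

occ-permute-letters : (x : Word m q) (π : Permutation′ q) (a : Fin q) → occ (λ i → π ⟨$⟩ʳ x i) (π ⟨$⟩ʳ a) ≡ occ x a
occ-permute-letters x π a = begin
  occ (λ i → π ⟨$⟩ʳ x i) (π ⟨$⟩ʳ a)                  ≡⟨ occ≡sum (λ i → π ⟨$⟩ʳ x i) (π ⟨$⟩ʳ a) ⟩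
  sum (λ i → indicator (π ⟨$⟩ʳ x i ≟ π ⟨$⟩ʳ a))      ≡⟨ sum-cong-≗ (λ i → indicator-cong (π ⟨$⟩ʳ x i ≟ π ⟨$⟩ʳ a) (x i ≟ a)
                                                                          (mk⇔ (permute-injective π) (cong (π ⟨$⟩ʳ_)))) ⟩
  sum (λ i → indicator (x i ≟ a))                    ≡⟨ occ≡sum x a ⟨
  occ x a                                            ∎
  where open ≡-Reasoning

occ-relabel : (x : Word m q) (π : Permutation′ q) (a : Fin q) → occ (λ i → π ⟨$⟩ʳ x i) a ≡ occ x (π ⟨$⟩ˡ a)
occ-relabel x π a = trans (cong (occ (λ i → π ⟨$⟩ʳ x i)) (sym (inverseʳ π))) (occ-permute-letters x π (π ⟨$⟩ˡ a))

occ-suc : (x : Word (suc m) q) (a : Fin q) → occ x a ≡ indicator (x zero ≟ a) + occ (x ∘ suc) a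
occ-suc x a rewrite occ≡sum x a | occ≡sum (x ∘ suc) a = refl

occ-self : (x : Word m q) (i : Fin m) → 1 ≤ occ x (x i)
occ-self x i rewrite occ≡sum x (x i) =
  subst (_≤ sum (λ j → indicator (x j ≟ x i))) (indicator-yes (x i ≟ x i) refl) (term≤sum _ i)

occ-absent : (x : Word m q) (a : Fin q) → (∀ i → x i ≢ a) → occ x a ≡ 0
occ-absent {m} x a absent = trans (occ≡sum x a)
  (trans (sum-cong-≗ (λ i → indicator-no (x i ≟ a) (absent i))) (sum-replicate-zero m))

occurs : (x : Word m q) (a : Fin q) → 1 ≤ occ x a → ∃ λ i → x i ≡ a
occurs x a 1≤occ with any? (λ i → x i ≟ a)
... | yes found = found
... | no absent = contradiction (subst (1 ≤_) (occ-absent x a (λ i xi≡a → absent (i , xi≡a))) 1≤occ) λ ()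

occ-++ : (x : Word m q) (y : Word n q) (a : Fin q) → occ (x ++ y) a ≡ occ x a + occ y a
occ-++ {m} x y a rewrite occ≡sum (x ++ y) a | occ≡sum x a | occ≡sum y a = begin
  sum (λ i → indicator ((x ++ y) i ≟ a))                               ≡⟨ sum-cong-≗ ([,]-∘ (λ b → indicator (b ≟ a)) ∘ splitAt m) ⟩
  sum ((λ i → indicator (x i ≟ a)) ++ (λ i → indicator (y i ≟ a)))    ≡⟨ sum-++ (λ i → indicator (x i ≟ a)) _ ⟩
  sum (λ i → indicator (x i ≟ a)) + sum (λ i → indicator (y i ≟ a))  ∎
  where open ≡-Reasoning

module _ {x y : Word m q} where

  occ-agree-off : ∀ {i} → (∀ j → j ≢ i → x j ≡ y j) → ∀ c → occ x c + indicator (y i ≟ c) ≡ occ y c + indicator (x i ≟ c)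
  occ-agree-off {i} x≗y c rewrite occ≡sum x c | occ≡sum y c =
    sum-agree-off _ _ i (λ j j≢i → cong (λ b → indicator (b ≟ c)) (x≗y j j≢i))

  occ-agree-off-two : ∀ {i j} → i ≢ j → (∀ t → t ≢ i → t ≢ j → x t ≡ y t) → ∀ c →
    occ x c + indicator (y i ≟ c) + indicator (y j ≟ c) ≡ occ y c + indicator (x i ≟ c) + indicator (x j ≟ c)
  occ-agree-off-two i≢j x≗y c rewrite occ≡sum x c | occ≡sum y c =
    sum-agree-off-two _ _ i≢j (λ t t≢i t≢j → cong (λ b → indicator (b ≟ c)) (x≗y t t≢i t≢j))

same-counts⇒rearrangement : (x y : Word m q) → (∀ a → occ x a ≡ occ y a) → ∃ λ ρ → ∀ j → x (ρ ⟨$⟩ʳ j) ≡ y j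
same-counts⇒rearrangement {zero}  x y _ = P.id , λ ()
same-counts⇒rearrangement {suc m} x y same = lift₀ ρ ∘ₚ τ , λ { zero → x′₀ ; (suc j) → ρ-maps j }
  where
  y₀-in-x = occurs x (y zero) (subst (1 ≤_) (sym (same (y zero))) (occ-self y zero))
  τ = transpose zero (proj₁ y₀-in-x)
  x′ : Word (suc m) _
  x′ j = x (τ ⟨$⟩ʳ j)
  x′₀ : x′ zero ≡ y zero
  x′₀ = trans (cong x (transpose-i↦j zero _)) (proj₂ y₀-in-x)
  tail-same : ∀ a → occ (x′ ∘ suc) a ≡ occ (y ∘ suc) a
  tail-same a = +-cancelˡ-≡ (indicator (y zero ≟ a)) _ _ (begin
    indicator (y zero ≟ a) + occ (x′ ∘ suc) a   ≡⟨ cong (λ b → indicator (b ≟ a) + occ (x′ ∘ suc) a) x′₀ ⟨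
    indicator (x′ zero ≟ a) + occ (x′ ∘ suc) a  ≡⟨ occ-suc x′ a ⟨
    occ x′ a                                    ≡⟨ occ-permute-positions x τ a ⟩
    occ x a                                     ≡⟨ same a ⟩
    occ y a                                     ≡⟨ occ-suc y a ⟩
    indicator (y zero ≟ a) + occ (y ∘ suc) a    ∎)
    where open ≡-Reasoning
  tail-rearrangement = same-counts⇒rearrangement (x′ ∘ suc) (y ∘ suc) tail-same
  ρ = proj₁ tail-rearrangement
  ρ-maps = proj₂ tail-rearrangement

mismatch : Word m q → Word m q → Fin m → ℕ
mismatch x y i = indicator (¬? (x i ≟ y i))

dist≡sum : (x y : Word m q) → dist x y ≡ sum (mismatch x y)
dist≡sum x y = length-filter-tabulate (λ i → ¬? (x i ≟ y i)) id

module _ {x y : Word m q} where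

  mismatch-≢ : ∀ {i} → x i ≢ y i → mismatch x y i ≡ 1
  mismatch-≢ {i} = indicator-yes (¬? (x i ≟ y i))

  mismatch-≡ : ∀ {i} → x i ≡ y i → mismatch x y i ≡ 0
  mismatch-≡ {i} xi≡yi = indicator-no (¬? (x i ≟ y i)) (λ xi≢yi → xi≢yi xi≡yi)

  dist-positive : ¬ x ≗ y → 1 ≤ dist x y
  dist-positive x≉y with ¬∀⟶∃¬ m _ (λ i → x i ≟ y i) x≉y
  ... | i , xi≢yi rewrite dist≡sum x y = subst (_≤ sum (mismatch x y)) (mismatch-≢ xi≢yi) (term≤sum _ i)

  adjacent⇒dist≡1 : Adjacent x y → dist x y ≡ 1
  adjacent⇒dist≡1 (i , xi≢yi , x≗y) rewrite dist≡sum x y =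
    trans (sum-supported-at _ i (λ j j≢i → mismatch-≡ (x≗y j j≢i))) (mismatch-≢ xi≢yi)

  dist-everywhere : (∀ i → x i ≢ y i) → dist x y ≡ m
  dist-everywhere x≢y rewrite dist≡sum x y = sum-ones _ (λ i → mismatch-≢ (x≢y i))

  dist-two : ∀ {i j} → i ≢ j → x i ≢ y i → x j ≢ y j → (∀ t → t ≢ i → t ≢ j → x t ≡ y t) → dist x y ≡ 2
  dist-two i≢j xi≢yi xj≢yj x≗y rewrite dist≡sum x y =
    trans (sum-supported-at-two _ i≢j (λ t t≢i t≢j → mismatch-≡ (x≗y t t≢i t≢j)))
          (cong₂ _+_ (mismatch-≢ xi≢yi) (mismatch-≢ xj≢yj))

  adjacent-or-dist≥2 : ¬ x ≗ y → Adjacent x y ⊎ 2 ≤ dist x y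
  adjacent-or-dist≥2 x≉y with ¬∀⟶∃¬ m _ (λ i → x i ≟ y i) x≉y
  ... | i , xi≢yi with any? (λ t → ¬? (t ≟ i) ×-dec ¬? (x t ≟ y t))
  ... | yes (t , t≢i , xt≢yt) rewrite dist≡sum x y =
    inj₂ (subst₂ (λ a b → a + b ≤ sum (mismatch x y)) (mismatch-≢ xi≢yi) (mismatch-≢ xt≢yt)
                 (sum-≥-two-terms _ (t≢i ∘ sym)))
  ... | no none = inj₁ (i , xi≢yi , agree)
    where
    agree : ∀ t → t ≢ i → x t ≡ y t
    agree t t≢i with x t ≟ y t
    ... | yes xt≡yt = xt≡yt
    ... | no xt≢yt  = contradiction (t , t≢i , xt≢yt) none

updateAt-adjacent : (x : Word m q) (i : Fin m) {b : Fin q} → x i ≢ b → Adjacent x (updateAt x i (const b))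
updateAt-adjacent x i xi≢b =
  i , (λ eq → xi≢b (trans eq (updateAt-updates i x))) , (λ j j≢i → sym (updateAt-minimal j i x j≢i))

-- The group Diag_m(S_q) ⋊ L

-- Diagrammatic order: act (g₁ · g₂) x ≗ act g₂ (act g₁ x) holds definitionally.
_·_ : Auto m q → Auto m q → Auto m q
g₁ · g₂ = mkAuto (λ j → h g₁ (σ g₂ ⟨$⟩ˡ j) ∘ₚ h g₂ j) (σ g₁ ∘ₚ σ g₂)

_⁻¹ : Auto m q → Auto m q
g ⁻¹ = mkAuto (λ j → P.flip (h g (σ g ⟨$⟩ʳ j))) (P.flip (σ g))

diagL : Permutation′ q → Permutation′ m → Auto m q
diagL π ρ = mkAuto (λ _ → π) ρ

act-⁻¹ : (g : Auto m q) (x : Word m q) → act (g ⁻¹) (act g x) ≗ x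
act-⁻¹ g x j = trans (inverseˡ (h g _)) (cong x (inverseˡ (σ g)))

inverses-agree : {π π′ : Permutation′ n} → (∀ a → π ⟨$⟩ʳ a ≡ π′ ⟨$⟩ʳ a) → ∀ a → π ⟨$⟩ˡ a ≡ π′ ⟨$⟩ˡ a
inverses-agree {π = π} {π′} π≗π′ a = begin
  π ⟨$⟩ˡ a                          ≡⟨ inverseˡ π′ ⟨
  π′ ⟨$⟩ˡ (π′ ⟨$⟩ʳ (π ⟨$⟩ˡ a))      ≡⟨ cong (π′ ⟨$⟩ˡ_) (π≗π′ _) ⟨
  π′ ⟨$⟩ˡ (π ⟨$⟩ʳ (π ⟨$⟩ˡ a))       ≡⟨ cong (π′ ⟨$⟩ˡ_) (inverseʳ π) ⟩
  π′ ⟨$⟩ˡ a                         ∎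
  where open ≡-Reasoning

InDiagL-· : {g₁ g₂ : Auto m q} → InDiagL g₁ → InDiagL g₂ → InDiagL (g₁ · g₂)
InDiagL-· {g₂ = g₂} d₁ d₂ i j a = trans (cong (h g₂ i ⟨$⟩ʳ_) (d₁ _ _ a)) (d₂ i j _)

InDiagL-⁻¹ : {g : Auto m q} → InDiagL g → InDiagL (g ⁻¹)
InDiagL-⁻¹ {g = g} d i j = inverses-agree {π = h g (σ g ⟨$⟩ʳ i)} {h g (σ g ⟨$⟩ʳ j)} (d (σ g ⟨$⟩ʳ i) (σ g ⟨$⟩ʳ j))

InDiagL-diagL : (π : Permutation′ q) (ρ : Permutation′ m) → InDiagL (diagL π ρ)
InDiagL-diagL π ρ i j a = refl

InDiagL-isAutGroup : IsAutGroup {m} {q} InDiagL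
InDiagL-isAutGroup =
  (diagL P.id P.id , InDiagL-diagL P.id P.id , λ x j → refl) ,
  (λ g₁ g₂ d₁ d₂ → g₁ · g₂ , InDiagL-· {g₁ = g₁} {g₂} d₁ d₂ , λ x j → refl) ,
  (λ g d → g ⁻¹ , InDiagL-⁻¹ {g = g} d , act-⁻¹ g)

act-InDiagL : {g : Auto m q} → InDiagL g → (i₀ : Fin m) (x : Word m q) → act g x ≗ act (diagL (h g i₀) (σ g)) x
act-InDiagL d i₀ x j = d j i₀ _

act-agree-off : (g : Auto m q) {x y : Word m q} {i : Fin m} → (∀ t → t ≢ i → x t ≡ y t) →
  ∀ j → j ≢ σ g ⟨$⟩ʳ i → act g x j ≡ act g y j
act-agree-off g x≗y j j≢σi =
  cong (h g j ⟨$⟩ʳ_) (x≗y _ (λ σ⁻¹j≡i → j≢σi (trans (sym (inverseʳ (σ g))) (cong (σ g ⟨$⟩ʳ_) σ⁻¹j≡i))))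

act-adjacent : (g : Auto m q) {x y : Word m q} → Adjacent x y → Adjacent (act g x) (act g y)
act-adjacent g {x} {y} (i , xi≢yi , x≗y) =
  σ g ⟨$⟩ʳ i ,
  (λ eq → xi≢yi (subst (λ t → x t ≡ y t) (inverseˡ (σ g)) (permute-injective (h g _) eq))) ,
  act-agree-off g x≗y

act-changed-at : (g : Auto m q) {x y x′ y′ : Word m q} {i i′ : Fin m} → σ g ⟨$⟩ʳ i ≡ i′ →
  (∀ t → t ≢ i → x t ≡ y t) → (∀ t → t ≢ i′ → x′ t ≡ y′ t) →
  act g x ≗ x′ → h g i′ ⟨$⟩ʳ y i ≡ y′ i′ → act g y ≗ y′
act-changed-at g {y = y} {i = i} {i′} refl x≗y x′≗y′ gx≗x′ hyi≡y′i′ j with j ≟ i′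
... | yes refl = trans (cong (λ t → h g j ⟨$⟩ʳ y t) (inverseˡ (σ g))) hyi≡y′i′
... | no j≢i′  = trans (sym (act-agree-off g x≗y j j≢i′)) (trans (gx≗x′ j) (x′≗y′ j j≢i′))

relabel-and-rearrange : {x y : Word m q} (π : Permutation′ q) → (∀ a → occ (λ i → π ⟨$⟩ʳ x i) a ≡ occ y a) →
  ∃ λ g → InDiagL g × act g x ≗ y
relabel-and-rearrange {x = x} {y} π same with ρ , ρ-maps ← same-counts⇒rearrangement (λ i → π ⟨$⟩ʳ x i) y same =
  diagL π (P.flip ρ) , InDiagL-diagL π (P.flip ρ) , ρ-maps

-- Criteria for neighbour transitivity, Aut(C) and minimum distance

DiagLInvariant : Code m q → Set
DiagLInvariant C = ∀ g → InDiagL g → ∀ {x} → C x → C (act g x)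

DiagLTransitive : Code m q → Set
DiagLTransitive C = ∀ x y → C x → C y → ∃ λ g → InDiagL g × act g x ≗ y

record IsSymmetric (C : Code m q) : Set where
  field
    respects-≗        : C Respects _≗_
    permute-letters   : ∀ π {x} → C x → C (λ i → π ⟨$⟩ʳ x i)
    permute-positions : ∀ ρ {x} → C x → C (λ i → x (ρ ⟨$⟩ʳ i))

symmetric⇒DiagLInvariant : {C : Code m q} → IsSymmetric C → DiagLInvariant C
symmetric⇒DiagLInvariant {zero}  sym-C g d Cx = IsSymmetric.respects-≗ sym-C (λ ()) Cx
symmetric⇒DiagLInvariant {suc _} sym-C g d {x} Cx =
  respects-≗ (λ j → sym (act-InDiagL {g = g} d zero x j))
    (permute-positions (P.flip (σ g)) (permute-letters (h g zero) Cx))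
  where open IsSymmetric sym-C

InDiagL⇒InAut : {C : Code m q} → C Respects _≗_ → DiagLInvariant C → ∀ g → InDiagL g → InAut C g
InDiagL⇒InAut respects invariant g d x = mk⇔ (invariant g d) λ Cgx →
  respects (act-⁻¹ g x) (invariant (g ⁻¹) (InDiagL-⁻¹ {g = g} d) Cgx)

neighbours-respects-≗ : {C : Code m q} → C Respects _≗_ → Neighbours C Respects _≗_
neighbours-respects-≗ respects y≗y′ (¬Cy , x , Cx , i , xi≢yi , x≗y) =
  (λ Cy′ → ¬Cy (respects (sym ∘ y≗y′) Cy′)) , x , Cx , i ,
  (λ xi≡y′i → xi≢yi (trans xi≡y′i (sym (y≗y′ i)))) , (λ j j≢i → trans (x≗y j j≢i) (y≗y′ j))

neighbours-DiagLInvariant : {C : Code m q} → C Respects _≗_ → DiagLInvariant C → DiagLInvariant (Neighbours C)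
neighbours-DiagLInvariant respects invariant g d {y} (¬Cy , x , Cx , adj) =
  (λ Cgy → ¬Cy (Equivalence.from (InDiagL⇒InAut respects invariant g d y) Cgy)) ,
  act g x , invariant g d Cx , act-adjacent g adj

DiagL-orbit : {S : Code m q} → S Respects _≗_ → DiagLInvariant S → ∃ S → DiagLTransitive S → IsOrbit InDiagL S
DiagL-orbit respects invariant inhabited transitive =
  inhabited , λ x y Sx → mk⇔ (transitive x y Sx) λ (g , d , gx≗y) → respects gx≗y (invariant g d Sx)

neighbourTransitive : {C : Code m q} → IsSymmetric C → ∃ C → DiagLTransitive C →
  ∃ (Neighbours C) → DiagLTransitive (Neighbours C) → NeighbourTransitive C
neighbourTransitive sym-C C-inhabited C-transitive C₁-inhabited C₁-transitive =
  InDiagL , InDiagL-isAutGroup ,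
  DiagL-orbit respects invariant C-inhabited C-transitive ,
  DiagL-orbit (neighbours-respects-≗ respects) (neighbours-DiagLInvariant respects invariant) C₁-inhabited C₁-transitive
  where
  respects = IsSymmetric.respects-≗ sym-C
  invariant = symmetric⇒DiagLInvariant sym-C

autIsDiagL : {C : Code m q} → IsSymmetric C → (∀ g → InAut C g → InDiagL g) → AutIsDiagL C
autIsDiagL sym-C InAut⇒InDiagL g =
  mk⇔ (InAut⇒InDiagL g) (InDiagL⇒InAut (IsSymmetric.respects-≗ sym-C) (symmetric⇒DiagLInvariant sym-C) g)

adjacent-to-codeword : {C : Code m q} → (∀ {x y} → C x → C y → ¬ Adjacent x y) →
  ∀ {x y} → C x → Adjacent x y → Neighbours C y
adjacent-to-codeword no-adjacent Cx adj = (λ Cy → no-adjacent Cx Cy adj) , _ , Cx , adj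

adjacent-codewords⇒minDist-1 : {C : Code m q} {x y : Word m q} → C x → C y → Adjacent x y → MinDist C 1
adjacent-codewords⇒minDist-1 Cx Cy adj@(i , xi≢yi , _) =
  (_ , _ , Cx , Cy , (λ x≗y → xi≢yi (x≗y i)) , adjacent⇒dist≡1 adj) , λ _ _ _ _ → dist-positive

codeword-with-entries : {C : Code m q} → IsSymmetric C → {x : Word m q} {s t : Fin m} → C x → x s ≢ x t →
  ∀ {i j a b} → i ≢ j → a ≢ b → ∃ λ z → C z × z i ≡ a × z j ≡ b
codeword-with-entries sym-C {x} Cx xs≢xt i≢j a≢b
  with ρ , ρi≡s , ρj≡t ← permutation-mapping-pair i≢j (xs≢xt ∘ cong x)
     | π , πxs≡a , πxt≡b ← permutation-mapping-pair xs≢xt a≢b =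
  (λ u → π ⟨$⟩ʳ x (ρ ⟨$⟩ʳ u)) ,
  permute-positions ρ (permute-letters π Cx) ,
  trans (cong (λ u → π ⟨$⟩ʳ x u) ρi≡s) πxs≡a ,
  trans (cong (λ u → π ⟨$⟩ʳ x u) ρj≡t) πxt≡b
  where open IsSymmetric sym-C

occ-act-swap : (g : Auto m q) (x : Word m q) {i j : Fin m} → i ≢ j → ∀ c →
  let s = σ g ⟨$⟩ˡ i ; t = σ g ⟨$⟩ˡ j ; [_] = λ b → indicator (b ≟ c) in
  occ (act g x) c + [ h g i ⟨$⟩ʳ x t ] + [ h g j ⟨$⟩ʳ x s ] ≡
  occ (act g (λ u → x (transpose s t ⟨$⟩ʳ u))) c + [ h g i ⟨$⟩ʳ x s ] + [ h g j ⟨$⟩ʳ x t ]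
occ-act-swap g x {i} {j} i≢j c =
  subst₂ (λ a b → occ (act g x) c + [ h g i ⟨$⟩ʳ x a ] + [ h g j ⟨$⟩ʳ x b ] ≡
                  occ (act g x′) c + [ h g i ⟨$⟩ʳ x s ] + [ h g j ⟨$⟩ʳ x t ])
         (transpose-i↦j s t) (transpose-j↦i s t) (occ-agree-off-two i≢j agree c)
  where
  s = σ g ⟨$⟩ˡ i
  t = σ g ⟨$⟩ˡ j
  [_] = λ b → indicator (b ≟ c)
  x′ = λ u → x (transpose s t ⟨$⟩ʳ u)
  σ⁻¹-≢ : ∀ {u v} → u ≢ v → σ g ⟨$⟩ˡ u ≢ σ g ⟨$⟩ˡ v
  σ⁻¹-≢ u≢v = u≢v ∘ permute-injective (P.flip (σ g))
  agree : ∀ u → u ≢ i → u ≢ j → act g x u ≡ act g x′ u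
  agree u u≢i u≢j = cong (λ v → h g u ⟨$⟩ʳ x v) (sym (transpose-fixes (σ⁻¹-≢ u≢i) (σ⁻¹-≢ u≢j)))

occ-act-swap-gain : (g : Auto m q) (x : Word m q) {i j : Fin m} → i ≢ j → ∀ {c} →
  let s = σ g ⟨$⟩ˡ i ; t = σ g ⟨$⟩ˡ j in
  x t ≢ x s → h g i ⟨$⟩ʳ x s ≡ c → h g j ⟨$⟩ʳ x s ≢ c →
  occ (act g x) c ≡ suc (occ (act g (λ u → x (transpose s t ⟨$⟩ʳ u))) c + indicator (h g j ⟨$⟩ʳ x t ≟ c))
occ-act-swap-gain g x {i} {j} i≢j {c} xt≢xs hixs≡c hjxs≢c = begin
  occ (act g x) c                                           ≡⟨ trans (+-identityʳ _) (+-identityʳ _) ⟨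
  occ (act g x) c + 0 + 0                                   ≡⟨ cong₂ (λ a b → occ (act g x) c + a + b) hixt hjxs ⟨
  occ (act g x) c + [ h g i ⟨$⟩ʳ x t ] + [ h g j ⟨$⟩ʳ x s ]  ≡⟨ occ-act-swap g x i≢j c ⟩
  occ (act g x′) c + [ h g i ⟨$⟩ʳ x s ] + [ h g j ⟨$⟩ʳ x t ] ≡⟨ cong (λ a → occ (act g x′) c + a + [ h g j ⟨$⟩ʳ x t ]) hixs ⟩
  occ (act g x′) c + 1 + [ h g j ⟨$⟩ʳ x t ]                 ≡⟨ +-suc-middle (occ (act g x′) c) _ ⟩
  suc (occ (act g x′) c + [ h g j ⟨$⟩ʳ x t ])               ∎
  where
  open ≡-Reasoning
  s = σ g ⟨$⟩ˡ i
  t = σ g ⟨$⟩ˡ j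
  [_] = λ b → indicator (b ≟ c)
  x′ = λ u → x (transpose s t ⟨$⟩ʳ u)
  +-suc-middle : ∀ a b → a + 1 + b ≡ suc (a + b)
  +-suc-middle = solve-∀
  hixt = indicator-no (h g i ⟨$⟩ʳ x t ≟ c) (λ eq → xt≢xs (permute-injective (h g i) (trans eq (sym hixs≡c))))
  hjxs = indicator-no (h g j ⟨$⟩ʳ x s ≟ c) hjxs≢c
  hixs = indicator-yes (h g i ⟨$⟩ʳ x s ≟ c) hixs≡c

-- Rep(m,q)

Rep-isSymmetric : IsSymmetric (Rep {m} {q})
Rep-isSymmetric = record
  { respects-≗        = λ { x≗y (a , x≡a) → a , λ i → trans (sym (x≗y i)) (x≡a i) }
  ; permute-letters   = λ { π (a , x≡a) → π ⟨$⟩ʳ a , cong (π ⟨$⟩ʳ_) ∘ x≡a }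
  ; permute-positions = λ { ρ (a , x≡a) → a , x≡a ∘ (ρ ⟨$⟩ʳ_) }
  }

Rep-transitive : DiagLTransitive (Rep {m} {q})
Rep-transitive _ _ (a , x≡a) (b , y≡b) =
  diagL (transpose a b) P.id , InDiagL-diagL (transpose a b) P.id ,
  λ j → trans (cong (transpose a b ⟨$⟩ʳ_) (x≡a j)) (trans (transpose-i↦j a b) (sym (y≡b j)))

Rep-distinct-differ-everywhere : {x y : Word m q} → Rep x → Rep y → ¬ x ≗ y → ∀ i → x i ≢ y i
Rep-distinct-differ-everywhere {x = x} {y} (a , x≡a) (b , y≡b) x≉y i xi≡yi = x≉y λ j → begin
  x j  ≡⟨ x≡a j ⟩
  a    ≡⟨ x≡a i ⟨
  x i  ≡⟨ xi≡yi ⟩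
  y i  ≡⟨ y≡b i ⟩
  b    ≡⟨ y≡b j ⟨
  y j  ∎
  where open ≡-Reasoning

Rep-no-adjacent : {x y : Word (suc (suc m)) q} → Rep x → Rep y → ¬ Adjacent x y
Rep-no-adjacent Rx Ry (i , xi≢yi , x≗y) =
  Rep-distinct-differ-everywhere Rx Ry (λ x≗y → xi≢yi (x≗y i)) j (x≗y j (punchInᵢ≢i i zero))
  where j = punchIn i zero

Rep-neighbour-shape : {y : Word m q} → Neighbours Rep y → ∃ λ c → ∃ λ i → y i ≢ c × (∀ t → t ≢ i → c ≡ y t)
Rep-neighbour-shape (_ , x , (c , x≡c) , i , xi≢yi , x≗y) =
  c , i , (λ yi≡c → xi≢yi (trans (x≡c i) (sym yi≡c))) , (λ t t≢i → trans (sym (x≡c t)) (x≗y t t≢i))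

Rep-neighbours-transitive : DiagLTransitive (Neighbours (Rep {m} {q}))
Rep-neighbours-transitive y y′ C₁y C₁y′
  with c , i , yi≢c , c≡y ← Rep-neighbour-shape C₁y
     | c′ , i′ , y′i′≢c′ , c′≡y′ ← Rep-neighbour-shape C₁y′
  with π , πc≡c′ , πyi≡y′i′ ← permutation-mapping-pair (yi≢c ∘ sym) (y′i′≢c′ ∘ sym) =
  g , InDiagL-diagL π (transpose i i′) ,
  act-changed-at g {x = λ _ → c} {x′ = λ _ → c′} (transpose-i↦j i i′) c≡y c′≡y′ (λ _ → πc≡c′) πyi≡y′i′
  where g = diagL π (transpose i i′)

Rep-result : Result (suc (suc m)) (suc (suc q)) Rep (suc (suc m))
Rep-result =
  neighbourTransitive Rep-isSymmetric (const 0F , Rep-const) Rep-transitive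
    (_ , adjacent-to-codeword Rep-no-adjacent Rep-const (updateAt-adjacent (const 0F) zero {1F} λ ()))
    Rep-neighbours-transitive ,
  autIsDiagL Rep-isSymmetric InAut⇒InDiagL ,
  (const 0F , const 1F , Rep-const , Rep-const , (λ 0≗1 → 0≢1 (0≗1 zero)) , dist-everywhere (λ _ → 0≢1)) ,
  (λ x y Rx Ry x≉y → ≤-reflexive (sym (dist-everywhere (Rep-distinct-differ-everywhere Rx Ry x≉y))))
  where
  Rep-const : ∀ {a} → Rep (const a)
  Rep-const {a} = a , λ _ → refl
  0≢1 : 0F ≢ 1F
  0≢1 ()
  InAut⇒InDiagL : ∀ g → InAut Rep g → InDiagL g
  InAut⇒InDiagL g ia i j a with c , ga≡c ← Equivalence.to (ia (const a)) Rep-const =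
    trans (ga≡c i) (sym (ga≡c j))

-- Inj(m,q)

Inj-isSymmetric : IsSymmetric (Inj {m} {q})
Inj-isSymmetric = record
  { respects-≗        = λ x≗y x-inj i j yi≡yj → x-inj i j (trans (x≗y i) (trans yi≡yj (sym (x≗y j))))
  ; permute-letters   = λ π x-inj i j eq → x-inj i j (permute-injective π eq)
  ; permute-positions = λ ρ x-inj i j eq → permute-injective ρ (x-inj _ _ eq)
  }

Inj-transitive : DiagLTransitive (Inj {m} {q})
Inj-transitive x y x-inj y-inj with π , πx≡y ← injections⇒relabelling x y x-inj y-inj =
  diagL π P.id , InDiagL-diagL π P.id , πx≡y

Inj-neighbour-shape : {y : Word m q} → Neighbours Inj y →
  ∃ λ x → Inj x × ∃ λ i → ∃ λ k → k ≢ i × (∀ t → t ≢ i → x t ≡ y t) × x k ≡ y i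
Inj-neighbour-shape {y = y} (¬Inj-y , x , x-inj , i , xi≢yi , x≗y) with any? (λ k → x k ≟ y i)
... | yes (k , xk≡yi) = x , x-inj , i , k , (λ k≡i → xi≢yi (subst (λ t → x t ≡ y i) k≡i xk≡yi)) , x≗y , xk≡yi
... | no y-fresh = contradiction y-inj ¬Inj-y
  where
  y-inj : Inj y
  y-inj u v yu≡yv with u ≟ i | v ≟ i
  ... | yes refl | yes refl = refl
  ... | yes refl | no v≢i   = contradiction (v , trans (x≗y v v≢i) (sym yu≡yv)) y-fresh
  ... | no u≢i   | yes refl = contradiction (u , trans (x≗y u u≢i) yu≡yv) y-fresh
  ... | no u≢i   | no v≢i   = x-inj u v (trans (x≗y u u≢i) (trans yu≡yv (sym (x≗y v v≢i))))

Inj-neighbours-transitive : DiagLTransitive (Neighbours (Inj {m} {q}))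
Inj-neighbours-transitive y y′ C₁y C₁y′
  with x , x-inj , i , k , k≢i , x≗y , xk≡yi ← Inj-neighbour-shape C₁y
     | x′ , x′-inj , i′ , k′ , k′≢i′ , x′≗y′ , x′k′≡y′i′ ← Inj-neighbour-shape C₁y′
  with ρ , ρi≡i′ , ρk≡k′ ← permutation-mapping-pair (k≢i ∘ sym) (k′≢i′ ∘ sym)
  with π , πx≡x′ ← injections⇒relabelling (λ u → x (ρ ⟨$⟩ˡ u)) x′
                     (IsSymmetric.permute-positions Inj-isSymmetric (P.flip ρ) x-inj) x′-inj =
  diagL π ρ , InDiagL-diagL π ρ , act-changed-at (diagL π ρ) ρi≡i′ x≗y x′≗y′ πx≡x′ (begin
    π ⟨$⟩ʳ y i               ≡⟨ cong (π ⟨$⟩ʳ_) xk≡yi ⟨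
    π ⟨$⟩ʳ x k               ≡⟨ cong (λ t → π ⟨$⟩ʳ x t) (trans (sym (inverseˡ ρ)) (cong (ρ ⟨$⟩ˡ_) ρk≡k′)) ⟩
    π ⟨$⟩ʳ x (ρ ⟨$⟩ˡ k′)     ≡⟨ πx≡x′ k′ ⟩
    x′ k′                    ≡⟨ x′k′≡y′i′ ⟩
    y′ i′                    ∎)
  where open ≡-Reasoning

Inj-result : suc (suc m) < q → Result (suc (suc m)) q Inj 1
Inj-result {m} {q} m<q =
  neighbourTransitive Inj-isSymmetric (x₀ , x₀-inj) Inj-transitive
    (_ , ¬Inj-y , x₀ , x₀-inj , updateAt-adjacent x₀ zero x₀0≢x₀1) Inj-neighbours-transitive ,
  autIsDiagL Inj-isSymmetric InAut⇒InDiagL ,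
  adjacent-codewords⇒minDist-1 x₀-inj (permute-letters τ x₀-inj) x₀-adjacent
  where
  open IsSymmetric Inj-isSymmetric
  x₀ : Word (suc (suc m)) q
  x₀ i = inject≤ i (<⇒≤ m<q)
  x₀-inj : Inj x₀
  x₀-inj i j = inject≤-injective _ _ i j
  x₀0≢x₀1 : x₀ zero ≢ x₀ (suc zero)
  x₀0≢x₀1 eq with () ← x₀-inj _ _ eq
  ¬Inj-y : ¬ Inj (updateAt x₀ zero (const (x₀ (suc zero))))
  ¬Inj-y y-inj with () ← y-inj zero (suc zero) refl
  fresh : Fin q
  fresh = fromℕ< m<q
  x₀≢fresh : ∀ {i} → x₀ i ≢ fresh
  x₀≢fresh {i} eq = <-irrefl (trans (sym (toℕ-inject≤ i _)) (trans (cong toℕ eq) (toℕ-fromℕ< m<q))) (toℕ<n i)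
  τ = transpose (x₀ zero) fresh
  x₀-adjacent : Adjacent x₀ (λ i → τ ⟨$⟩ʳ x₀ i)
  x₀-adjacent = zero , (λ eq → x₀≢fresh (trans eq (transpose-i↦j (x₀ zero) fresh))) ,
    λ t t≢0 → sym (transpose-fixes (t≢0 ∘ x₀-inj _ _) x₀≢fresh)
  InAut⇒InDiagL : ∀ g → InAut Inj g → InDiagL g
  InAut⇒InDiagL g ia i j a with i ≟ j | h g i ⟨$⟩ʳ a ≟ h g j ⟨$⟩ʳ a
  ... | yes refl | _        = refl
  ... | no _     | yes eq   = eq
  ... | no i≢j   | no hia≢hja
    with z , z-inj , zs≡a , zt≡b ← codeword-with-entries Inj-isSymmetric x₀-inj x₀0≢x₀1
                                     (i≢j ∘ permute-injective (P.flip (σ g)))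
                                     (λ a≡b → hia≢hja (sym (trans (cong (h g j ⟨$⟩ʳ_) a≡b) (inverseʳ (h g j)))))
    = contradiction (Equivalence.to (ia z) z-inj i j (begin
        h g i ⟨$⟩ʳ z (σ g ⟨$⟩ˡ i)  ≡⟨ cong (h g i ⟨$⟩ʳ_) zs≡a ⟩
        h g i ⟨$⟩ʳ a               ≡⟨ inverseʳ (h g j) ⟨
        h g j ⟨$⟩ʳ (h g j ⟨$⟩ˡ (h g i ⟨$⟩ʳ a))  ≡⟨ cong (h g j ⟨$⟩ʳ_) zt≡b ⟨
        h g j ⟨$⟩ʳ z (σ g ⟨$⟩ˡ j)  ∎)) i≢j
    where
    open ≡-Reasoning

-- W([m/2],2)

Fin2-≢⇒≡ : {a b c : Fin 2} → a ≢ c → b ≢ c → a ≡ b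
Fin2-≢⇒≡ {0F} {0F} _   _   = refl
Fin2-≢⇒≡ {1F} {1F} _   _   = refl
Fin2-≢⇒≡ {0F} {1F} {0F} a≢c _ = contradiction refl a≢c
Fin2-≢⇒≡ {0F} {1F} {1F} _ b≢c = contradiction refl b≢c
Fin2-≢⇒≡ {1F} {0F} {0F} _ b≢c = contradiction refl b≢c
Fin2-≢⇒≡ {1F} {0F} {1F} a≢c _ = contradiction refl a≢c

Fin2-permutations-agree : (π π′ : Permutation′ 2) {a : Fin 2} → π ⟨$⟩ʳ a ≡ π′ ⟨$⟩ʳ a → ∀ b → π ⟨$⟩ʳ b ≡ π′ ⟨$⟩ʳ b
Fin2-permutations-agree π π′ {a} πa≡π′a b with b ≟ a
... | yes refl = πa≡π′a
... | no b≢a   = Fin2-≢⇒≡ (b≢a ∘ permute-injective π) (λ eq → b≢a (permute-injective π′ (trans eq πa≡π′a)))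

occ-0F+occ-1F : (x : Word m 2) → occ x 0F + occ x 1F ≡ m
occ-0F+occ-1F {zero}  x = refl
occ-0F+occ-1F {suc m} x rewrite occ-suc x 0F | occ-suc x 1F with x zero
... | 0F = cong suc (occ-0F+occ-1F (x ∘ suc))
... | 1F = trans (+-suc _ _) (cong suc (occ-0F+occ-1F (x ∘ suc)))

binary-adjacent-weights : {x y : Word m 2} → Adjacent x y → occ y 1F ≡ suc (occ x 1F) ⊎ suc (occ y 1F) ≡ occ x 1F
binary-adjacent-weights {x = x} {y} (i , xi≢yi , x≗y) with x i ≟ 1F | y i ≟ 1F | occ-agree-off x≗y 1F
... | yes xi≡1 | yes yi≡1 | _  = contradiction (trans xi≡1 (sym yi≡1)) xi≢yi
... | no xi≢1  | no yi≢1  | _  = contradiction (Fin2-≢⇒≡ xi≢1 yi≢1) xi≢yi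
... | no _     | yes _    | eq = inj₁ (sym (trans (+-comm 1 _) (trans eq (+-identityʳ _))))
... | yes _    | no _     | eq = inj₂ (trans (+-comm 1 _) (trans (sym eq) (+-identityʳ _)))

binary-counts : (x y : Word m 2) → occ x 1F ≡ occ y 1F → ∀ a → occ x a ≡ occ y a
binary-counts x y same 0F = +-cancelʳ-≡ (occ x 1F) _ _
  (trans (occ-0F+occ-1F x) (trans (sym (occ-0F+occ-1F y)) (cong (occ y 0F +_) (sym same))))
binary-counts x y same 1F = same

binary-related : {x y : Word m 2} → occ x 1F ≡ occ y 1F ⊎ occ x 1F + occ y 1F ≡ m → ∃ λ g → InDiagL g × act g x ≗ y
binary-related {x = x} {y} (inj₁ same) = relabel-and-rearrange {x = x} P.id (binary-counts x y same)
binary-related {x = x} {y} (inj₂ complementary) =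
  relabel-and-rearrange {x = x} swap (binary-counts (λ i → swap ⟨$⟩ʳ x i) y (+-cancelʳ-≡ (occ x 1F) _ _ (begin
    occ (λ i → swap ⟨$⟩ʳ x i) 1F + occ x 1F  ≡⟨ cong (_+ occ x 1F) (occ-permute-letters x swap 0F) ⟩
    occ x 0F + occ x 1F                      ≡⟨ occ-0F+occ-1F x ⟩
    _                                        ≡⟨ complementary ⟨
    occ x 1F + occ y 1F                      ≡⟨ +-comm (occ x 1F) _ ⟩
    occ y 1F + occ x 1F                      ∎)))
  where
  open ≡-Reasoning
  swap = transpose 0F 1F

binary-relabel-weight : (π : Permutation′ 2) (x : Word m 2) →
  occ (λ i → π ⟨$⟩ʳ x i) 1F ≡ occ x 1F ⊎ occ x 1F + occ (λ i → π ⟨$⟩ʳ x i) 1F ≡ m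
binary-relabel-weight π x with π ⟨$⟩ˡ 1F | occ-relabel x π 1F
... | 1F | same = inj₁ same
... | 0F | same = inj₂ (trans (cong (occ x 1F +_) same) (trans (+-comm (occ x 1F) _) (occ-0F+occ-1F x)))

-- Codewords of W k have weights in the window {k, k+1} and their neighbours weights in {k-1, k+2}; both
-- windows are symmetric about m/2, so two weights in one window are equal or complementary, and complementing
-- the letters is a relabelling.
OneOf : ℕ → ℕ → ℕ → Set
OneOf r s a = a ≡ r ⊎ a ≡ s

module _ {r s n : ℕ} (r+s≡n : r + s ≡ n) where

  oneOf-complement : ∀ {a b} → a + b ≡ n → OneOf r s a → OneOf r s b
  oneOf-complement a+b≡n (inj₁ refl) = inj₂ (+-cancelˡ-≡ r _ _ (trans a+b≡n (sym r+s≡n)))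
  oneOf-complement a+b≡n (inj₂ refl) = inj₁ (+-cancelˡ-≡ s _ _ (trans a+b≡n (trans (sym r+s≡n) (+-comm r s))))

  oneOf-paired : ∀ {a b} → OneOf r s a → OneOf r s b → a ≡ b ⊎ a + b ≡ n
  oneOf-paired (inj₁ refl) (inj₁ refl) = inj₁ refl
  oneOf-paired (inj₂ refl) (inj₂ refl) = inj₁ refl
  oneOf-paired (inj₁ refl) (inj₂ refl) = inj₂ r+s≡n
  oneOf-paired (inj₂ refl) (inj₁ refl) = inj₂ (trans (+-comm s r) r+s≡n)

oneOf-consecutive-≢2+ : ∀ {r a b} → OneOf r (suc r) a → OneOf r (suc r) b → a ≢ suc (suc b)
oneOf-consecutive-≢2+ {r} {a} {b} wa wb a≡2+b = 1+n≰n (begin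
  suc (suc r)  ≤⟨ s≤s (s≤s (lower wb)) ⟩
  suc (suc b)  ≡⟨ a≡2+b ⟨
  a            ≤⟨ upper wa ⟩
  suc r        ∎)
  where
  open ≤-Reasoning
  lower : ∀ {c} → OneOf r (suc r) c → r ≤ c
  lower (inj₁ refl) = ≤-refl
  lower (inj₂ refl) = n≤1+n r
  upper : ∀ {c} → OneOf r (suc r) c → c ≤ suc r
  upper (inj₁ refl) = n≤1+n r
  upper (inj₂ refl) = ≤-refl

step-out-of-window : ∀ {k a b} → OneOf (suc k) (suc (suc k)) a → ¬ OneOf (suc k) (suc (suc k)) b →
  b ≡ suc a ⊎ suc b ≡ a → OneOf k (suc (suc (suc k))) b
step-out-of-window (inj₁ refl) b∉ (inj₁ refl)  = contradiction (inj₂ refl) b∉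
step-out-of-window (inj₁ refl) b∉ (inj₂ 1+b≡a) = inj₁ (Nat.suc-injective 1+b≡a)
step-out-of-window (inj₂ refl) b∉ (inj₁ refl)  = inj₂ refl
step-out-of-window (inj₂ refl) b∉ (inj₂ 1+b≡a) = contradiction (inj₁ (Nat.suc-injective 1+b≡a)) b∉

module _ {m k : ℕ} (window : k + suc k ≡ m) where

  W-isSymmetric : IsSymmetric (W {m} k)
  W-isSymmetric = record
    { respects-≗        = λ x≗y → subst (OneOf k (suc k)) (occ-cong x≗y 1F)
    ; permute-letters   = λ π {x} Wx → [ (λ same → subst (OneOf k (suc k)) (sym same) Wx)
                                       , (λ complementary → oneOf-complement window complementary Wx)
                                       ]′ (binary-relabel-weight π x)
    ; permute-positions = λ ρ {x} → subst (OneOf k (suc k)) (sym (occ-permute-positions x ρ 1F))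
    }

  W-transitive : DiagLTransitive (W {m} k)
  W-transitive _ _ Wx Wy = binary-related (oneOf-paired window Wx Wy)

  W-swap-absurd : ∀ g → InAut (W k) g → ∀ {i j} → i ≢ j → ∀ {z} → W k z →
    let s = σ g ⟨$⟩ˡ i ; t = σ g ⟨$⟩ˡ j in
    z t ≢ z s → h g i ⟨$⟩ʳ z s ≡ 1F → h g j ⟨$⟩ʳ z s ≢ 1F → ⊥
  W-swap-absurd g ia {i} {j} i≢j {z} Wz zt≢zs hizs≡1 hjzs≢1 = oneOf-consecutive-≢2+
    (Equivalence.to (ia z) Wz)
    (Equivalence.to (ia z′) (IsSymmetric.permute-positions W-isSymmetric (transpose s t) Wz))
    (trans (occ-act-swap-gain g z i≢j zt≢zs hizs≡1 hjzs≢1) (cong suc (trans (cong (occ (act g z′) 1F +_) hjzt) (+-comm _ 1))))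
    where
    s = σ g ⟨$⟩ˡ i
    t = σ g ⟨$⟩ˡ j
    z′ = λ u → z (transpose s t ⟨$⟩ʳ u)
    hjzt = indicator-yes (h g j ⟨$⟩ʳ z t ≟ 1F) (Fin2-≢⇒≡ (zt≢zs ∘ permute-injective (h g j)) (hjzs≢1 ∘ sym))

  W-InAut⇒InDiagL : {x : Word m 2} {s t : Fin m} → W k x → x s ≢ x t → ∀ g → InAut (W k) g → InDiagL g
  W-InAut⇒InDiagL Wx xs≢xt g ia i j with i ≟ j
  ... | yes refl = λ _ → refl
  ... | no i≢j
    with z , Wz , zs≡a , zt≡b ← codeword-with-entries W-isSymmetric Wx xs≢xt
                                  (i≢j ∘ permute-injective (P.flip (σ g))) (punchInᵢ≢i (h g i ⟨$⟩ˡ 1F) 0F ∘ sym)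
    with h g j ⟨$⟩ʳ (h g i ⟨$⟩ˡ 1F) ≟ 1F
  ... | yes hja≡1 = Fin2-permutations-agree (h g i) (h g j) (trans (inverseʳ (h g i)) (sym hja≡1))
  ... | no hja≢1  = ⊥-elim (
    W-swap-absurd g ia i≢j Wz (λ zt≡zs → punchInᵢ≢i _ 0F (trans (sym zt≡b) (trans zt≡zs zs≡a)))
      (trans (cong (h g i ⟨$⟩ʳ_) zs≡a) (inverseʳ (h g i))) (hja≢1 ∘ trans (cong (h g j ⟨$⟩ʳ_) (sym zs≡a))))

leadingOnes : ℕ → Word m 2
leadingOnes zero    _       = 0F
leadingOnes (suc r) zero    = 1F
leadingOnes (suc r) (suc j) = leadingOnes r j

occ-leadingOnes : ∀ {r} → r ≤ m → occ (leadingOnes {m} r) 1F ≡ r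
occ-leadingOnes {m}     {zero}  _         = occ-absent (leadingOnes {m} 0) 1F λ _ ()
occ-leadingOnes {suc m} {suc r} (s≤s r≤m) = trans (occ-suc (leadingOnes {suc m} (suc r)) 1F) (cong suc (occ-leadingOnes r≤m))

leadingOnes-adjacent : ∀ {r} → r < m → Adjacent (leadingOnes {m} r) (leadingOnes (suc r))
leadingOnes-adjacent {r = zero}  (s≤s _) = zero , (λ ()) , λ { zero 0≢0 → contradiction refl 0≢0 ; (suc j) _ → refl }
leadingOnes-adjacent {r = suc r} (s≤s r<m) with i , onesi≢ , agree ← leadingOnes-adjacent r<m =
  suc i , onesi≢ , λ { zero _ → refl ; (suc j) j≢i → agree j (j≢i ∘ cong suc) }

module _ {m k′ : ℕ} (window : suc k′ + suc (suc k′) ≡ m) where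

  private
    k = suc k′

  W-neighbour-weight : {y : Word m 2} → Neighbours (W k) y → OneOf k′ (suc (suc k)) (occ y 1F)
  W-neighbour-weight (¬Wy , x , Wx , adj) = step-out-of-window Wx ¬Wy (binary-adjacent-weights adj)

  W-neighbours-transitive : DiagLTransitive (Neighbours (W {m} k))
  W-neighbours-transitive _ _ C₁x C₁y =
    binary-related (oneOf-paired (trans (+-suc k′ _) window) (W-neighbour-weight C₁x) (W-neighbour-weight C₁y))

  W-result : Result m 2 (W k) 1
  W-result =
    neighbourTransitive (W-isSymmetric window) (leadingOnes k , inj₁ weight-k) (W-transitive window)
      (leadingOnes (suc (suc k)) , ¬W-ones-k+2 , leadingOnes (suc k) , inj₂ weight-k+1 , leadingOnes-adjacent 2+k≤m)
      W-neighbours-transitive ,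
    autIsDiagL (W-isSymmetric window)
      (W-InAut⇒InDiagL window {s = proj₁ one-at} {proj₁ zero-at} (inj₁ weight-k)
        (λ 1≡0 → 1≢0 (trans (sym (proj₂ one-at)) (trans 1≡0 (proj₂ zero-at))))) ,
    adjacent-codewords⇒minDist-1 (inj₁ weight-k) (inj₂ weight-k+1) (leadingOnes-adjacent 1+k≤m)
    where
    2+k≤m : suc (suc k) ≤ m
    2+k≤m = subst (suc (suc k) ≤_) window (s≤s (m≤n+m (suc k) k′))
    1+k≤m : suc k ≤ m
    1+k≤m = ≤-trans (n≤1+n (suc k)) 2+k≤m
    weight-k : occ (leadingOnes {m} k) 1F ≡ k
    weight-k = occ-leadingOnes (≤-trans (n≤1+n k) 1+k≤m)
    weight-k+1 : occ (leadingOnes {m} (suc k)) 1F ≡ suc k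
    weight-k+1 = occ-leadingOnes 1+k≤m
    ¬W-ones-k+2 : ¬ W k (leadingOnes {m} (suc (suc k)))
    ¬W-ones-k+2 W-ones = oneOf-consecutive-≢2+ W-ones (inj₁ refl) (occ-leadingOnes 2+k≤m)
    zeros-k+1 : occ (leadingOnes {m} k) 0F ≡ suc k
    zeros-k+1 = +-cancelʳ-≡ k _ _ (trans (cong (occ (leadingOnes {m} k) 0F +_) (sym weight-k))
                                   (trans (occ-0F+occ-1F (leadingOnes {m} k)) (trans (sym window) (+-comm k (suc k)))))
    one-at = occurs (leadingOnes {m} k) 1F (subst (1 ≤_) (sym weight-k) (s≤s z≤n))
    zero-at = occurs (leadingOnes {m} k) 0F (subst (1 ≤_) (sym zeros-k+1) (s≤s z≤n))
    1≢0 : 1F ≢ 0F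
    1≢0 ()

-- All(pq,q)

occ-identity : (a : Fin q) → occ (λ (i : Fin q) → i) a ≡ 1
occ-identity a = trans (occ≡sum (λ i → i) a)
  (trans (sum-supported-at _ a (λ j j≢a → indicator-no (j ≟ a) j≢a)) (indicator-yes (a ≟ a) refl))

balanced : ∀ p → Word (p * q) q
balanced zero    = λ ()
balanced (suc p) = (λ i → i) ++ balanced p

occ-balanced : ∀ p (a : Fin q) → occ (balanced p) a ≡ p
occ-balanced zero    a = refl
occ-balanced (suc p) a = trans (occ-++ (λ i → i) (balanced p) a) (cong₂ _+_ (occ-identity a) (occ-balanced p a))

module _ {m q : ℕ} (p : ℕ) where

  All-isSymmetric : IsSymmetric (All {m} {q} p)
  All-isSymmetric = record
    { respects-≗        = λ x≗y Ax a → trans (sym (occ-cong x≗y a)) (Ax a)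
    ; permute-letters   = λ π {x} Ax a → trans (occ-relabel x π a) (Ax (π ⟨$⟩ˡ a))
    ; permute-positions = λ ρ {x} Ax a → trans (occ-permute-positions x ρ a) (Ax a)
    }

  All-transitive : DiagLTransitive (All {m} {q} p)
  All-transitive x _ Ax Ay = relabel-and-rearrange {x = x} P.id (λ a → trans (Ax a) (sym (Ay a)))

  All-no-adjacent : {x y : Word m q} → All p x → All p y → ¬ Adjacent x y
  All-no-adjacent {x} {y} Ax Ay (i , xi≢yi , x≗y) = m≢1+m+n p {0} (begin
    p                                   ≡⟨ +-identityʳ p ⟨
    p + 0                               ≡⟨ cong₂ _+_ (Ax (x i)) (indicator-no (y i ≟ x i) (xi≢yi ∘ sym)) ⟨
    occ x (x i) + indicator (y i ≟ x i) ≡⟨ occ-agree-off x≗y (x i) ⟩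
    occ y (x i) + indicator (x i ≟ x i) ≡⟨ cong₂ _+_ (Ay (x i)) (indicator-yes (x i ≟ x i) refl) ⟩
    p + 1                               ≡⟨ +-comm p 1 ⟩
    suc p                               ≡⟨ cong suc (+-identityʳ p) ⟨
    suc (p + 0)                         ∎)
    where open ≡-Reasoning

  All-neighbour-counts : {y : Word m q} → Neighbours (All p) y →
    ∃ λ a → ∃ λ b → a ≢ b × (∀ c → occ y c + indicator (a ≟ c) ≡ p + indicator (b ≟ c))
  All-neighbour-counts {y} (_ , x , Ax , i , xi≢yi , x≗y) =
    x i , y i , xi≢yi , λ c → sym (trans (cong (_+ indicator (y i ≟ c)) (sym (Ax c))) (occ-agree-off x≗y c))

  All-neighbours-transitive : DiagLTransitive (Neighbours (All {m} {q} p))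
  All-neighbours-transitive y y′ C₁y C₁y′
    with a , b , a≢b , counts ← All-neighbour-counts C₁y
       | a′ , b′ , a′≢b′ , counts′ ← All-neighbour-counts C₁y′
    with π , πa≡a′ , πb≡b′ ← permutation-mapping-pair a≢b a′≢b′ =
    relabel-and-rearrange {x = y} π λ d → +-cancelʳ-≡ (indicator (a′ ≟ d)) _ _ (begin
      occ (λ i → π ⟨$⟩ʳ y i) d + indicator (a′ ≟ d)  ≡⟨ cong₂ _+_ (occ-relabel y π d) (sym (relabel πa≡a′)) ⟩
      occ y (π ⟨$⟩ˡ d) + indicator (a ≟ π ⟨$⟩ˡ d)    ≡⟨ counts (π ⟨$⟩ˡ d) ⟩
      p + indicator (b ≟ π ⟨$⟩ˡ d)                   ≡⟨ cong (p +_) (relabel πb≡b′) ⟩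
      p + indicator (b′ ≟ d)                         ≡⟨ counts′ d ⟨
      occ y′ d + indicator (a′ ≟ d)                  ∎)
    where
    open ≡-Reasoning
    relabel : ∀ {e e′ d} → π ⟨$⟩ʳ e ≡ e′ → indicator (e ≟ π ⟨$⟩ˡ d) ≡ indicator (e′ ≟ d)
    relabel πe≡e′ = indicator-cong (_ ≟ _) (_ ≟ _) (mk⇔
      (λ e≡πd → trans (sym πe≡e′) (trans (cong (π ⟨$⟩ʳ_) e≡πd) (inverseʳ π)))
      (λ e′≡d → trans (sym (inverseˡ π)) (cong (π ⟨$⟩ˡ_) (trans πe≡e′ e′≡d))))

All-InAut⇒InDiagL : ∀ {m q p} {x : Word m (suc (suc q))} {s t : Fin m} → All p x → x s ≢ x t →
  (g : Auto m (suc (suc q))) → InAut (All p) g → InDiagL g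
All-InAut⇒InDiagL {p = p} Ax xs≢xt g ia i j a with i ≟ j
... | yes refl = refl
... | no i≢j
  with z , Az , zs≡a , zt≡b ← codeword-with-entries (All-isSymmetric p) Ax xs≢xt
                                (i≢j ∘ permute-injective (P.flip (σ g))) (punchInᵢ≢i a 0F ∘ sym)
  with h g j ⟨$⟩ʳ a ≟ h g i ⟨$⟩ʳ a
... | yes hja≡hia = sym hja≡hia
... | no hja≢hia  = contradiction (begin
  p                                          ≡⟨ Equivalence.to (ia z) Az c ⟨
  occ (act g z) c                            ≡⟨ occ-act-swap-gain g z i≢j zt≢zs refl hjzs≢c ⟩
  suc (occ (act g z′) c + extra)             ≡⟨ cong (λ n → suc (n + extra)) (Equivalence.to (ia z′) Az′ c) ⟩
  suc (p + extra)                            ∎) (m≢1+m+n p)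
  where
  open ≡-Reasoning
  s = σ g ⟨$⟩ˡ i
  t = σ g ⟨$⟩ˡ j
  c = h g i ⟨$⟩ʳ z s
  extra = indicator (h g j ⟨$⟩ʳ z t ≟ c)
  z′ = λ u → z (transpose s t ⟨$⟩ʳ u)
  Az′ = IsSymmetric.permute-positions (All-isSymmetric p) (transpose s t) {z} Az
  zt≢zs : z t ≢ z s
  zt≢zs zt≡zs = punchInᵢ≢i a 0F (trans (sym zt≡b) (trans zt≡zs zs≡a))
  hjzs≢c : h g j ⟨$⟩ʳ z s ≢ c
  hjzs≢c eq = hja≢hia (trans (cong (h g j ⟨$⟩ʳ_) (sym zs≡a)) (trans eq (cong (h g i ⟨$⟩ʳ_) zs≡a)))

All-result : ∀ {p q} → Result (suc p * suc (suc q)) (suc (suc q)) (All (suc p)) 2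
All-result {p} {q} =
  neighbourTransitive All-sym (x₀ , Ax₀) (All-transitive (suc p))
    (_ , adjacent-to-codeword (All-no-adjacent (suc p)) Ax₀ (updateAt-adjacent x₀ zero {1F} λ ()))
    (All-neighbours-transitive (suc p)) ,
  autIsDiagL All-sym (All-InAut⇒InDiagL {x = x₀} {0F} {1F} Ax₀ x₀0≢x₀1) ,
  (x₀ , x₁ , Ax₀ , Ax₁ , (λ x₀≗x₁ → x₀0≢x₀1 (x₀≗x₁ 0F)) , dist-two (λ ()) x₀0≢x₀1 (x₀0≢x₀1 ∘ sym) agree) ,
  λ x y Ax Ay x≉y → [ (λ adj → contradiction adj (All-no-adjacent (suc p) Ax Ay)) , (λ 2≤d → 2≤d) ]′ (adjacent-or-dist≥2 x≉y)
  where
  All-sym : IsSymmetric (All {suc p * suc (suc q)} {suc (suc q)} (suc p))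
  All-sym = All-isSymmetric (suc p)
  x₀ : Word (suc p * suc (suc q)) (suc (suc q))
  x₀ = balanced (suc p)
  Ax₀ : All (suc p) x₀
  Ax₀ = occ-balanced (suc p)
  τ = transpose 0F 1F
  x₁ : Word (suc p * suc (suc q)) (suc (suc q))
  x₁ u = x₀ (τ ⟨$⟩ʳ u)
  Ax₁ : All (suc p) x₁
  Ax₁ = IsSymmetric.permute-positions All-sym τ {x₀} Ax₀
  x₀0≢x₀1 : x₀ 0F ≢ x₀ 1F
  x₀0≢x₀1 ()
  agree : ∀ t → t ≢ 0F → t ≢ 1F → x₀ t ≡ x₁ t
  agree t t≢0 t≢1 = cong x₀ (sym (transpose-fixes t≢0 t≢1))

theorem3p3 :
    (∀ m q → 2 ≤ m → 2 ≤ q → Result m q Rep m) ×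
    (∀ m q → 2 ≤ m → 2 ≤ q → m < q → Result m q Inj 1) ×
    (∀ m k → 3 ≤ m → m ≡ 2 * k + 1 → Result m 2 (W k) 1) ×
    (∀ m q p → 2 ≤ m → 2 ≤ q → 1 ≤ p → m ≡ p * q → Result m q (All p) 2)
theorem3p3 = repetition , injective , weight , balancedCode
  where
  repetition : ∀ m q → 2 ≤ m → 2 ≤ q → Result m q Rep m
  repetition (suc (suc _)) (suc (suc _)) (s≤s (s≤s _)) (s≤s (s≤s _)) = Rep-result
  injective : ∀ m q → 2 ≤ m → 2 ≤ q → m < q → Result m q Inj 1
  injective (suc (suc _)) _ (s≤s (s≤s _)) _ m<q = Inj-result m<q
  weight : ∀ m k → 3 ≤ m → m ≡ 2 * k + 1 → Result m 2 (W k) 1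
  weight (suc zero)    zero (s≤s ()) _
  weight (suc (suc _)) zero _ ()
  weight m (suc k) _ m≡2k+1 = W-result (trans (window k) (sym m≡2k+1))
    where
    window : ∀ k → suc k + suc (suc k) ≡ 2 * suc k + 1
    window = solve-∀
  balancedCode : ∀ m q p → 2 ≤ m → 2 ≤ q → 1 ≤ p → m ≡ p * q → Result m q (All p) 2
  balancedCode _ (suc (suc _)) (suc _) _ (s≤s (s≤s _)) (s≤s _) refl = All-result
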